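{- Let $n$, $d$ and $k$ be positive integers such that $d\ge 3$ (and $d+1\le n/2$). If $C$ is an identifying code in $C_n(1,d-1,d,d+1)$ with $k$ codewords, then there exists an identifying code in the infinite king grid $\mathcal{K}$ with density $k/n$. Analogously, a locating-dominating (respectively self-identifying) code in $C_n(1,d-1,d,d+1)$ with $k$ codewords yields a locating-dominating (respectively self-identifying) code in $\mathcal{K}$ with density $k/n$.
   Context: All graphs are simple and undirected. For a graph $G=(V,E)$ and $u\in V$, $N[u]=\{u\}\cup\{v: uv\in E\}$. A code is a nonempty $C\subseteq V$, and $I(C;u)=N[u]\cap C$. $C$ is dominating if $I(C;u)\neq\emptyset$ for all $u$; identifying if dominating and $I(C;u)\neq I(C;v)$ for all distinct $u,v\in V$; locating-dominating if dominating and $I(C;u)\neq I(C;v)$ for all distinct $u,v\in V\setminus C$; self-identifying if $I(C;u)\setminus I(C;v)\neq\emptyset$ for all distinct $u,v\in V$. For positive integers $n$ and $d_1,\dots,d_k\le n/2$, the circulant graph $C_n(d_1,\dots,d_k)$ has vertex set $\mathbb{Z}_n$, and the open neighbourhood of $u$ is $\{u\pm d_1,\dots,u\pm d_k\}$ modulo $n$. The infinite king grid $\mathcal{K}$ has vertex set $\mathbb{Z}^2$ and $N[(x,y)]=\{(x',y')\in\mathbb{Z}^2: |x-x'|\le1,|y-y'|\le1\}$. With $Q_m=\{(x,y)\in\mathbb{Z}^2:|x|\le m,|y|\le m\}$, the density of $C\subseteq\mathbb{Z}^2$ is $\limsup_{m\to\infty}|C\cap Q_m|/|Q_m|$. -}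

module Defs where

open import Data.Bool using (Bool; true; false; if_then_else_)
open import Data.Nat as ℕ using (ℕ; zero; suc)
open import Data.Integer as ℤ using (ℤ; +_)
open import Data.Rational as ℚ using (ℚ; _/_)
open import Data.Fin using (Fin; toℕ)
open import Data.List using (List; []; _∷_; map; upTo; allFin; concatMap)
open import Data.Nat.ListAction using (sum)
open import Data.Product using (Σ; ∃; _×_; _,_)
open import Data.Sum using (_⊎_)
open import Relation.Binary.PropositionalEquality using (_≡_; _≢_)
open import Relation.Nullary using (¬_)
open import Function.Bundles using (_⇔_)

-- Graphs, given by their closed neighbourhoods:  _∈N[_] w u  means w ∈ N[u].
-- (Simple undirected graphs; N[u] = {u} ∪ neighbours of u.)

record Graph : Set₁ where
  field
    V     : Set
    _∈N[_] : V → V → Set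
open Graph public

Code : Graph → Set
Code G = V G → Bool

Nonempty : (G : Graph) → Code G → Set
Nonempty G C = ∃ λ u → C u ≡ true

InI : (G : Graph) → Code G → V G → V G → Set
InI G C u w = (_∈N[_] G w u) × (C w ≡ true)

SameI : (G : Graph) → Code G → V G → V G → Set
SameI G C u v = ∀ w → (InI G C u w) ⇔ (InI G C v w)

IsDominating : (G : Graph) → Code G → Set
IsDominating G C = Nonempty G C × (∀ u → ∃ λ w → InI G C u w)

IsIdentifying : (G : Graph) → Code G → Set
IsIdentifying G C = IsDominating G C × (∀ u v → u ≢ v → ¬ SameI G C u v)

IsLocatingDominating : (G : Graph) → Code G → Set
IsLocatingDominating G C =
  IsDominating G C ×
  (∀ u v → u ≢ v → C u ≡ false → C v ≡ false → ¬ SameI G C u v)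

IsSelfIdentifying : (G : Graph) → Code G → Set
IsSelfIdentifying G C =
  Nonempty G C ×
  (∀ u v → u ≢ v → ∃ λ w → (InI G C u w) × ¬ (InI G C v w))

_≡_[modℤ_] : ℤ → ℤ → ℕ → Set
a ≡ b [modℤ n ] = Σ ℤ λ t → a ℤ.- b ≡ t ℤ.* (+ n)

CircAdj : (n : ℕ) → List ℕ → Fin n → Fin n → Set
CircAdj n [] u w = Data.Empty.⊥ where import Data.Empty
CircAdj n (s ∷ ds) u w =
  ((+ toℕ w) ≡ (+ toℕ u) ℤ.+ (+ s) [modℤ n ]) ⊎
  ((+ toℕ w) ≡ (+ toℕ u) ℤ.- (+ s) [modℤ n ]) ⊎
  CircAdj n ds u w

Circulant : (n : ℕ) → List ℕ → Graph
Circulant n ds = record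
  { V = Fin n
  ; _∈N[_] = λ w u → (w ≡ u) ⊎ CircAdj n ds u w
  }

codeSize : (n : ℕ) → (Fin n → Bool) → ℕ
codeSize n C = sum (map (λ i → if C i then 1 else 0) (allFin n))

KingGrid : Graph
KingGrid = record
  { V = ℤ × ℤ
  ; _∈N[_] = λ { (x' , y') (x , y) →
      (ℤ.∣ x ℤ.- x' ∣ ℕ.≤ 1) × (ℤ.∣ y ℤ.- y' ∣ ℕ.≤ 1) }
  }

range : ℕ → List ℤ
range m = map (λ i → (+ i) ℤ.- (+ m)) (upTo (suc (2 ℕ.* m)))

countQ : (ℤ × ℤ → Bool) → ℕ → ℕ
countQ C m = sum (concatMap (λ x → map (λ y → if C (x , y) then 1 else 0) (range m)) (range m))

-- |Q_m| = (2m+1)^2 = suc (4 m (m+1))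
sizeQ : ℕ → ℕ
sizeQ m = suc (4 ℕ.* m ℕ.* suc m)

ratioQ : (ℤ × ℤ → Bool) → ℕ → ℚ
ratioQ C m = (+ countQ C m) / sizeQ m

-- limsup_{m→∞} a m = q  (ε-characterisation of limsup of a bounded sequence):
-- eventually a m ≤ q + ε, and infinitely often a m ≥ q - ε, for every ε > 0.
LimsupEq : (ℕ → ℚ) → ℚ → Set
LimsupEq a q =
  (∀ ε → ℚ.Positive ε → ∃ λ M → ∀ m → M ℕ.≤ m → a m ℚ.≤ q ℚ.+ ε) ×
  (∀ ε → ℚ.Positive ε → ∀ M → ∃ λ m → (M ℕ.≤ m) × (q ℚ.- ε ℚ.≤ a m))

HasDensity : (ℤ × ℤ → Bool) → ℚ → Set
HasDensity C q = LimsupEq (ratioQ C) q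

module Submission where

-- The map φ (x , y) = y + d·x mod n from ℤ² to ℤₙ sends the king neighbourhood u + {-1,0,1}²
-- onto the closed neighbourhood φ u + {0, ±1, ±(d-1), ±d, ±(d+1)} in C_n(1, d-1, d, d+1).
-- Hence I(C ∘ φ; u) maps onto I(C; φ u), and vertices of ℤ² with distinct images inherit
-- domination and separation from C. Two distinct vertices with equal images and a common
-- neighbour w differ by ±(2,2), which can happen only when n = 2d + 2; then the corner of N[u]
-- opposite to w has the same image as w and separates them.
-- Each row of Q_m reads C along 2m + 1 consecutive residues, so it holds (2m + 1)k/n + O(n + k)
-- codewords, and C ∘ φ has density k/n.

open import Data.Bool using (Bool; true; false; T; if_then_else_)
open import Data.Empty using (⊥-elim)
open import Data.Fin using (Fin; toℕ)
open import Data.List using (List; []; _∷_)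
open import Data.Nat as ℕ using (ℕ; NonZero)
import Data.Nat.Properties as ℕP
import Data.Nat.Tactic.RingSolver as ℕSolver
open import Data.Integer as ℤ using (ℤ)
import Data.Integer.Properties as ℤP
open import Data.Integer.Tactic.RingSolver using (solve-∀)
open import Data.Product using (Σ; ∃; _×_; _,_; proj₁; proj₂)
open import Data.Sum using (_⊎_; inj₁; inj₂; [_,_]′)
open import Function using (_∘_; id)
open import Function.Bundles using (mk⇔; Equivalence)
open import Data.Bool.Properties using () renaming (_≟_ to _≟ᵇ_)
open import Relation.Binary.Definitions using (DecidableEquality)
open import Relation.Binary.PropositionalEquality
open import Relation.Nullary using (¬_; Dec; yes; no)
open import Relation.Nullary.Decidable using (_×-dec_)
open import Defs

module Congruence (n : ℕ) .{{_ : NonZero n}} where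
  open import Data.Integer using (+_; -[1+_]; _+_; _*_; _-_; -_; ∣_∣)
  open import Data.Integer.DivMod using (_%ℕ_; _/ℕ_; n%ℕd<d; a≡a%ℕn+[a/ℕn]*n)
  open import Data.Fin using (fromℕ<)
  import Data.Fin.Properties as FP
  open import Level using (0ℓ)
  open import Relation.Binary.Bundles using (Setoid)
  import Relation.Binary.Reasoning.Setoid as SetoidReasoning

  -- A record around _≡_[modℤ_], so that both sides can be inferred from a proof.
  infix 4 _≈_
  record _≈_ (a b : ℤ) : Set where
    constructor mod
    field
      witness : a ≡ b [modℤ n ]

  ≈-reflexive : ∀ {a b} → a ≡ b → a ≈ b
  ≈-reflexive {a} refl = mod (+ 0 , ℤP.+-inverseʳ a)

  ≈-sym : ∀ {a b} → a ≈ b → b ≈ a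
  ≈-sym {a} {b} (mod (t , eq)) = mod (- t , (begin
      b - a           ≡⟨ swap a b ⟩
      - (a - b)       ≡⟨ cong -_ eq ⟩
      - (t * + n)     ≡⟨ ℤP.neg-distribˡ-* t (+ n) ⟩
      - t * + n       ∎))
    where
    open ≡-Reasoning
    swap : ∀ a b → b - a ≡ - (a - b)
    swap = solve-∀

  ≈-trans : ∀ {a b c} → a ≈ b → b ≈ c → a ≈ c
  ≈-trans {a} {b} {c} (mod (s , eq₁)) (mod (t , eq₂)) = mod (s + t , (begin
      a - c                    ≡⟨ split a b c ⟩
      (a - b) + (b - c)        ≡⟨ cong₂ _+_ eq₁ eq₂ ⟩
      s * + n + t * + n        ≡⟨ ℤP.*-distribʳ-+ (+ n) s t ⟨
      (s + t) * + n            ∎))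
    where
    open ≡-Reasoning
    split : ∀ a b c → a - c ≡ (a - b) + (b - c)
    split = solve-∀

  ≈-setoid : Setoid 0ℓ 0ℓ
  ≈-setoid = record
    { Carrier = ℤ
    ; _≈_ = _≈_
    ; isEquivalence = record { refl = ≈-reflexive refl ; sym = ≈-sym ; trans = ≈-trans }
    }

  module ≈-Reasoning = SetoidReasoning ≈-setoid

  ≈-+ʳ : ∀ {a b} c → a ≈ b → a + c ≈ b + c
  ≈-+ʳ {a} {b} c (mod (t , eq)) = mod (t , trans (cancel a b c) eq)
    where
    cancel : ∀ a b c → (a + c) - (b + c) ≡ a - b
    cancel = solve-∀

  ≈-+ˡ : ∀ a {b c} → b ≈ c → a + b ≈ a + c
  ≈-+ˡ a {b} {c} (mod (t , eq)) = mod (t , trans (cancel a b c) eq)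
    where
    cancel : ∀ a b c → (a + b) - (a + c) ≡ b - c
    cancel = solve-∀

  ≈-+-cancelˡ : ∀ {a b c d} → a ≈ b → a + c ≈ b + d → c ≈ d
  ≈-+-cancelˡ {a} {b} {c} {d} (mod (s , eq₁)) (mod (t , eq₂)) = mod (t - s , (begin
      c - d                              ≡⟨ split a b c d ⟩
      (a + c - (b + d)) - (a - b)        ≡⟨ cong₂ _-_ eq₂ eq₁ ⟩
      t * + n - s * + n                  ≡⟨ factor t s (+ n) ⟩
      (t - s) * + n                      ∎))
    where
    open ≡-Reasoning
    split : ∀ a b c d → c - d ≡ (a + c - (b + d)) - (a - b)
    split = solve-∀
    factor : ∀ t s m → t * m - s * m ≡ (t - s) * m
    factor = solve-∀

  ≈⇒-≈0 : ∀ {a b} → a ≈ b → a - b ≈ + 0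
  ≈⇒-≈0 {a} {b} (mod (t , eq)) = mod (t , trans (ℤP.+-identityʳ (a - b)) eq)

  ≈-small : ∀ {a b} → a ≈ b → ∣ a - b ∣ ℕ.< n → a ≡ b
  ≈-small {a} {b} (mod (t , eq)) lt = ℤP.i-j≡0⇒i≡j a b (trans eq (cong (_* + n) (ℤP.∣i∣≡0⇒i≡0 {t} ∣t∣≡0)))
    where
    ∣t∣*n<1*n : ∣ t ∣ ℕ.* n ℕ.< 1 ℕ.* n
    ∣t∣*n<1*n = begin-strict
      ∣ t ∣ ℕ.* n    ≡⟨ ℤP.abs-* t (+ n) ⟨
      ∣ t * + n ∣    ≡⟨ cong ∣_∣ eq ⟨
      ∣ a - b ∣      <⟨ lt ⟩
      n              ≡⟨ ℕP.*-identityˡ n ⟨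
      1 ℕ.* n        ∎
      where open ℕP.≤-Reasoning
    ∣t∣≡0 : ∣ t ∣ ≡ 0
    ∣t∣≡0 = ℕP.n<1⇒n≡0 (ℕP.*-cancelʳ-< n ∣ t ∣ 1 ∣t∣*n<1*n)

  ≈0-small : ∀ {c} → c ≈ + 0 → ∣ c ∣ ℕ.< n → c ≡ + 0
  ≈0-small {c} c≈0 lt = ≈-small c≈0 (subst (λ x → ∣ x ∣ ℕ.< n) (sym (ℤP.+-identityʳ c)) lt)

  +[1+]≉0 : ∀ {m} → ℕ.suc m ℕ.< n → ¬ (+ ℕ.suc m ≈ + 0)
  +[1+]≉0 lt c≈0 with () ← ≈0-small c≈0 lt

  -[1+]≉0 : ∀ {m} → ℕ.suc m ℕ.< n → ¬ (-[1+ m ] ≈ + 0)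
  -[1+]≉0 lt c≈0 with () ← ≈0-small c≈0 lt

  toℕ-≈-injective : ∀ {x y : Fin n} → + toℕ x ≈ + toℕ y → x ≡ y
  toℕ-≈-injective {x} {y} x≈y = FP.toℕ-injective (ℤP.+-injective (≈-small x≈y (begin-strict
      ∣ + toℕ x - + toℕ y ∣   ≡⟨ cong ∣_∣ (ℤP.m-n≡m⊖n (toℕ x) (toℕ y)) ⟩
      ∣ toℕ x ℤ.⊖ toℕ y ∣     ≤⟨ ℤP.∣m⊝n∣≤m⊔n (toℕ x) (toℕ y) ⟩
      toℕ x ℕ.⊔ toℕ y         <⟨ ℕP.⊔-lub (FP.toℕ<n x) (FP.toℕ<n y) ⟩
      n                       ∎)))
    where open ℕP.≤-Reasoning

  reduce : ℤ → Fin n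
  reduce a = fromℕ< (n%ℕd<d a n)

  reduce-≈ : ∀ a → + toℕ (reduce a) ≈ a
  reduce-≈ a = mod (- (a /ℕ n) , (begin
      + toℕ (reduce a) - a                          ≡⟨ cong (λ r → + r - a) (FP.toℕ-fromℕ< (n%ℕd<d a n)) ⟩
      + (a %ℕ n) - a                                ≡⟨ cong (λ x → + (a %ℕ n) - x) (a≡a%ℕn+[a/ℕn]*n a n) ⟩
      + (a %ℕ n) - (+ (a %ℕ n) + (a /ℕ n) * + n)    ≡⟨ cancel (+ (a %ℕ n)) (a /ℕ n) (+ n) ⟩
      - (a /ℕ n) * + n                              ∎))
    where
    open ≡-Reasoning
    cancel : ∀ r q m → r - (r + q * m) ≡ - q * m
    cancel = solve-∀

  reduce-unique : ∀ {x a} → + toℕ x ≈ a → reduce a ≡ x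
  reduce-unique {x} {a} x≈a = toℕ-≈-injective (≈-trans (reduce-≈ a) (≈-sym x≈a))

  reduce-cong : ∀ {a b} → a ≈ b → reduce a ≡ reduce b
  reduce-cong {a} a≈b = sym (reduce-unique (≈-trans (reduce-≈ a) a≈b))

  reduce-injective : ∀ {a b} → reduce a ≡ reduce b → a ≈ b
  reduce-injective {a} {b} eq = ≈-trans (≈-sym (reduce-≈ a)) (subst (λ x → + toℕ x ≈ b) (sym eq) (reduce-≈ b))

  reduce-toℕ : ∀ x → reduce (+ toℕ x) ≡ x
  reduce-toℕ x = reduce-unique (≈-reflexive refl)

module KingOffsets where
  open import Data.Integer using (+_; -[1+_]; _+_; _*_; _-_; -_; ∣_∣)
  open import Data.Nat using (zero; suc; z≤n; s≤s)
  open import Algebra.Properties.AbelianGroup ℤP.+-0-abelianGroup using () renaming (∙-cancelʳ to +-cancelʳ)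

  infix 4 _∈K_
  _∈K_ : ℤ × ℤ → ℤ × ℤ → Set
  _∈K_ = _∈N[_] KingGrid

  data Step : Set where
    -1ₛ 0ₛ +1ₛ : Step

  ⟦_⟧ : Step → ℤ
  ⟦ -1ₛ ⟧ = - + 1
  ⟦ 0ₛ ⟧ = + 0
  ⟦ +1ₛ ⟧ = + 1

  Offset : Set
  Offset = Step × Step

  infixl 6 _⊕_
  _⊕_ : ℤ × ℤ → Offset → ℤ × ℤ
  (x , y) ⊕ (a , b) = x + ⟦ a ⟧ , y + ⟦ b ⟧

  ∣⟦⟧∣≤1 : ∀ a → ∣ ⟦ a ⟧ ∣ ℕ.≤ 1
  ∣⟦⟧∣≤1 -1ₛ = s≤s z≤n
  ∣⟦⟧∣≤1 0ₛ = z≤n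
  ∣⟦⟧∣≤1 +1ₛ = s≤s z≤n

  step-within-1 : ∀ x a → ∣ x - (x + ⟦ a ⟧) ∣ ℕ.≤ 1
  step-within-1 x a = subst (ℕ._≤ 1) (sym (trans (cong ∣_∣ (cancel x ⟦ a ⟧)) (ℤP.∣-i∣≡∣i∣ ⟦ a ⟧))) (∣⟦⟧∣≤1 a)
    where
    cancel : ∀ x k → x - (x + k) ≡ - k
    cancel = solve-∀

  within-1-step : ∀ x x' → ∣ x - x' ∣ ℕ.≤ 1 → Σ Step λ a → x' ≡ x + ⟦ a ⟧
  within-1-step x x' h = classify (x' - x) refl (subst (ℕ._≤ 1) (ℤP.∣i-j∣≡∣j-i∣ x x') h)
    where
    restore : ∀ x x' → x' ≡ x + (x' - x)
    restore = solve-∀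
    at : ∀ {k} a → x' - x ≡ k → k ≡ ⟦ a ⟧ → Σ Step λ a → x' ≡ x + ⟦ a ⟧
    at a eq refl = a , trans (restore x x') (cong (λ k → x + k) eq)
    classify : ∀ k → x' - x ≡ k → ∣ k ∣ ℕ.≤ 1 → Σ Step λ a → x' ≡ x + ⟦ a ⟧
    classify (+ zero) eq _ = at 0ₛ eq refl
    classify (+ suc zero) eq _ = at +1ₛ eq refl
    classify -[1+ zero ] eq _ = at -1ₛ eq refl
    classify (+ suc (suc _)) _ (s≤s ())
    classify -[1+ suc _ ] _ (s≤s ())

  ⊕-∈K : ∀ u s → u ⊕ s ∈K u
  ⊕-∈K (x , y) (a , b) = step-within-1 x a , step-within-1 y b

  ∈K⇒⊕ : ∀ {w u} → w ∈K u → Σ Offset λ s → w ≡ u ⊕ s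
  ∈K⇒⊕ {x' , y'} {x , y} (hx , hy) with within-1-step x x' hx | within-1-step y y' hy
  ... | a , refl | b , refl = (a , b) , refl

  ∈K? : ∀ w u → Dec (w ∈K u)
  ∈K? (x' , y') (x , y) = (∣ x - x' ∣ ℕ.≤? 1) ×-dec (∣ y - y' ∣ ℕ.≤? 1)

  ⊕-cancelʳ : ∀ {u v} s → u ⊕ s ≡ v ⊕ s → u ≡ v
  ⊕-cancelʳ {x , y} {x' , y'} (a , b) eq =
    cong₂ _,_ (+-cancelʳ ⟦ a ⟧ x x' (cong proj₁ eq)) (+-cancelʳ ⟦ b ⟧ y y' (cong proj₂ eq))

  data Antipodal : Offset → Offset → Set where
    ↗↙ : Antipodal (+1ₛ , +1ₛ) (-1ₛ , -1ₛ)
    ↙↗ : Antipodal (-1ₛ , -1ₛ) (+1ₛ , +1ₛ)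

  distance-three : ∀ {x y} k → x + k ≡ y - k → y - (x - k) ≡ + 3 * k
  distance-three {x} {y} k eq = begin
      y - (x - k)                       ≡⟨ regroup x y k ⟩
      ((y - k) - (x + k)) + + 3 * k     ≡⟨ cong (λ t → (t - (x + k)) + + 3 * k) eq ⟨
      ((x + k) - (x + k)) + + 3 * k     ≡⟨ cancel (x + k) (+ 3 * k) ⟩
      + 3 * k                           ∎
    where
    open ≡-Reasoning
    regroup : ∀ x y k → y - (x - k) ≡ ((y - k) - (x + k)) + + 3 * k
    regroup = solve-∀
    cancel : ∀ a b → (a - a) + b ≡ b
    cancel = solve-∀

  3≰1 : ¬ (3 ℕ.≤ 1)
  3≰1 (s≤s ())

  -- If u ⊕ s = v ⊕ s' for antipodal s, s', then v = u + 2s lies at distance 3 from u ⊕ s' = u - s.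
  antipodal-apart : ∀ {u v s s'} → Antipodal s s' → u ⊕ s ≡ v ⊕ s' → ¬ (u ⊕ s' ∈K v)
  antipodal-apart {x , _} {x' , _} ↗↙ eq (close , _) =
    3≰1 (subst (ℕ._≤ 1) (cong ∣_∣ (distance-three {x} {x'} (+ 1) (cong proj₁ eq))) close)
  antipodal-apart {x , _} {x' , _} ↙↗ eq (close , _) =
    3≰1 (subst (ℕ._≤ 1) (cong ∣_∣ (distance-three {x} {x'} (- + 1) (cong proj₁ eq))) close)

  data Gap : Set where
    -2ᵍ -1ᵍ 0ᵍ +1ᵍ +2ᵍ : Gap

  ⟦_⟧ᵍ : Gap → ℤ
  ⟦ -2ᵍ ⟧ᵍ = - + 2
  ⟦ -1ᵍ ⟧ᵍ = - + 1
  ⟦ 0ᵍ ⟧ᵍ = + 0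
  ⟦ +1ᵍ ⟧ᵍ = + 1
  ⟦ +2ᵍ ⟧ᵍ = + 2

  infix 6 _⊖_
  _⊖_ : Step → Step → Gap
  -1ₛ ⊖ -1ₛ = 0ᵍ
  -1ₛ ⊖ 0ₛ = -1ᵍ
  -1ₛ ⊖ +1ₛ = -2ᵍ
  0ₛ ⊖ -1ₛ = +1ᵍ
  0ₛ ⊖ 0ₛ = 0ᵍ
  0ₛ ⊖ +1ₛ = -1ᵍ
  +1ₛ ⊖ -1ₛ = +2ᵍ
  +1ₛ ⊖ 0ₛ = +1ᵍ
  +1ₛ ⊖ +1ₛ = 0ᵍ

  ⟦⊖⟧ : ∀ a b → ⟦ a ⊖ b ⟧ᵍ ≡ ⟦ a ⟧ - ⟦ b ⟧
  ⟦⊖⟧ -1ₛ -1ₛ = refl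
  ⟦⊖⟧ -1ₛ 0ₛ = refl
  ⟦⊖⟧ -1ₛ +1ₛ = refl
  ⟦⊖⟧ 0ₛ -1ₛ = refl
  ⟦⊖⟧ 0ₛ 0ₛ = refl
  ⟦⊖⟧ 0ₛ +1ₛ = refl
  ⟦⊖⟧ +1ₛ -1ₛ = refl
  ⟦⊖⟧ +1ₛ 0ₛ = refl
  ⟦⊖⟧ +1ₛ +1ₛ = refl

  ⊖-inversion : ∀ a b → (a ⊖ b ≡ 0ᵍ → a ≡ b)
                      × (a ⊖ b ≡ +2ᵍ → a ≡ +1ₛ × b ≡ -1ₛ)
                      × (a ⊖ b ≡ -2ᵍ → a ≡ -1ₛ × b ≡ +1ₛ)
  ⊖-inversion -1ₛ -1ₛ = (λ _ → refl) , (λ ()) , (λ ())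
  ⊖-inversion -1ₛ 0ₛ = (λ ()) , (λ ()) , (λ ())
  ⊖-inversion -1ₛ +1ₛ = (λ ()) , (λ ()) , (λ _ → refl , refl)
  ⊖-inversion 0ₛ -1ₛ = (λ ()) , (λ ()) , (λ ())
  ⊖-inversion 0ₛ 0ₛ = (λ _ → refl) , (λ ()) , (λ ())
  ⊖-inversion 0ₛ +1ₛ = (λ ()) , (λ ()) , (λ ())
  ⊖-inversion +1ₛ -1ₛ = (λ ()) , (λ _ → refl , refl) , (λ ())
  ⊖-inversion +1ₛ 0ₛ = (λ ()) , (λ ()) , (λ ())
  ⊖-inversion +1ₛ +1ₛ = (λ _ → refl) , (λ ()) , (λ ())

  gaps⇒offsets : ∀ a b a' b' → (a ⊖ a' ≡ 0ᵍ × b ⊖ b' ≡ 0ᵍ) ⊎ (a ⊖ a' ≡ +2ᵍ × b ⊖ b' ≡ +2ᵍ) ⊎ (a ⊖ a' ≡ -2ᵍ × b ⊖ b' ≡ -2ᵍ) →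
                 (a , b) ≡ (a' , b') ⊎ Antipodal (a , b) (a' , b')
  gaps⇒offsets a b a' b' (inj₁ (x , y)) = inj₁ (cong₂ _,_ (proj₁ (⊖-inversion a a') x) (proj₁ (⊖-inversion b b') y))
  gaps⇒offsets a b a' b' (inj₂ (inj₁ (x , y))) = inj₂ (↗↙-from (proj₁ (proj₂ (⊖-inversion a a')) x) (proj₁ (proj₂ (⊖-inversion b b')) y))
    where
    ↗↙-from : ∀ {a b a' b'} → a ≡ +1ₛ × a' ≡ -1ₛ → b ≡ +1ₛ × b' ≡ -1ₛ → Antipodal (a , b) (a' , b')
    ↗↙-from (refl , refl) (refl , refl) = ↗↙
  gaps⇒offsets a b a' b' (inj₂ (inj₂ (x , y))) = inj₂ (↙↗-from (proj₂ (proj₂ (⊖-inversion a a')) x) (proj₂ (proj₂ (⊖-inversion b b')) y))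
    where
    ↙↗-from : ∀ {a b a' b'} → a ≡ -1ₛ × a' ≡ +1ₛ → b ≡ -1ₛ × b' ≡ +1ₛ → Antipodal (a , b) (a' , b')
    ↙↗-from (refl , refl) (refl , refl) = ↙↗

open KingOffsets

isSelfIdentifying⇒dominating : ∀ G (C : Code G) → (∀ u → ∃ λ v → v ≢ u) →
                             IsSelfIdentifying G C → ∀ u → ∃ λ w → InI G C u w
isSelfIdentifying⇒dominating G C other (_ , separating) u with other u
... | v , v≢u with separating u v (v≢u ∘ sym)
...   | w , w∈I[u] , _ = w , w∈I[u]

module Pullback (H G : Graph) (φ : V H → V G)
  (φ-∈N : ∀ {w u} → _∈N[_] H w u → _∈N[_] G (φ w) (φ u))
  (φ-lift-∈N : ∀ {z u} → _∈N[_] G z (φ u) → Σ (V H) λ w → _∈N[_] H w u × φ w ≡ z)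
  (C : Code G) where

  C′ : Code H
  C′ = C ∘ φ

  I-push : ∀ {u w} → InI H C′ u w → InI G C (φ u) (φ w)
  I-push (w∈u , Cw) = φ-∈N w∈u , Cw

  I-lift : ∀ {u z} → InI G C (φ u) z → Σ (V H) λ w → InI H C′ u w × φ w ≡ z
  I-lift (z∈ , Cz) with φ-lift-∈N z∈
  ... | w , w∈u , refl = w , (w∈u , Cz) , refl

  nonempty : (∀ z → ∃ λ u → φ u ≡ z) → Nonempty G C → Nonempty H C′
  nonempty surjective (z , Cz) with surjective z
  ... | u , refl = u , Cz

  dominated : (∀ z → ∃ λ w → InI G C z w) → ∀ u → ∃ λ w → InI H C′ u w
  dominated dom u with I-lift (proj₂ (dom (φ u)))
  ... | w , w∈I[u] , _ = w , w∈I[u]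

  SameI-push : ∀ {u v} → SameI H C′ u v → SameI G C (φ u) (φ v)
  SameI-push {u} {v} same z = mk⇔ (transport (Equivalence.to ∘ same)) (transport (Equivalence.from ∘ same))
    where
    transport : ∀ {u v} → (∀ w → InI H C′ u w → InI H C′ v w) → InI G C (φ u) z → InI G C (φ v) z
    transport u⊆v z∈I[φu] with I-lift z∈I[φu]
    ... | w , w∈I[u] , refl = I-push (u⊆v w w∈I[u])

  separation-lift : ∀ {u v} → (∃ λ z → InI G C (φ u) z × ¬ InI G C (φ v) z) →
                    ∃ λ w → InI H C′ u w × ¬ InI H C′ v w
  separation-lift (z , z∈I[φu] , z∉I[φv]) with I-lift z∈I[φu]
  ... | w , w∈I[u] , refl = w , w∈I[u] , z∉I[φv] ∘ I-push

  FibreSeparating : Set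
  FibreSeparating = ∀ {u v w} → u ≢ v → φ u ≡ φ v → InI H C′ u w → InI H C′ v w →
                    ∃ λ w′ → InI H C′ u w′ × ¬ InI H C′ v w′

  module _ (surjective : ∀ z → ∃ λ u → φ u ≡ z) (_≟_ : DecidableEquality (V G))
           (fibre-separating : FibreSeparating) where

    fibre-¬SameI : (∀ u → ∃ λ w → InI H C′ u w) → ∀ {u v} → u ≢ v → φ u ≡ φ v → ¬ SameI H C′ u v
    fibre-¬SameI dom {u} {v} u≢v φu≡φv same with dom v
    ... | w , w∈I[v] with fibre-separating u≢v φu≡φv (Equivalence.from (same w) w∈I[v]) w∈I[v]
    ...   | w′ , w′∈I[u] , w′∉I[v] = w′∉I[v] (Equivalence.to (same w′) w′∈I[u])

    isIdentifying : IsIdentifying G C → IsIdentifying H C′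
    isIdentifying ((ne , dom) , separating) = (nonempty surjective ne , dominated dom) , separating′
      where
      separating′ : ∀ u v → u ≢ v → ¬ SameI H C′ u v
      separating′ u v u≢v with φ u ≟ φ v
      ... | yes φu≡φv = fibre-¬SameI (dominated dom) u≢v φu≡φv
      ... | no φu≢φv = separating (φ u) (φ v) φu≢φv ∘ SameI-push

    isLocatingDominating : IsLocatingDominating G C → IsLocatingDominating H C′
    isLocatingDominating ((ne , dom) , separating) = (nonempty surjective ne , dominated dom) , separating′
      where
      separating′ : ∀ u v → u ≢ v → C′ u ≡ false → C′ v ≡ false → ¬ SameI H C′ u v
      separating′ u v u≢v Cu Cv with φ u ≟ φ v
      ... | yes φu≡φv = fibre-¬SameI (dominated dom) u≢v φu≡φv
      ... | no φu≢φv = separating (φ u) (φ v) φu≢φv Cu Cv ∘ SameI-push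

    isSelfIdentifying : (∀ z → ∃ λ z′ → z′ ≢ z) → (∀ w u → Dec (_∈N[_] H w u)) →
                      IsSelfIdentifying G C → IsSelfIdentifying H C′
    isSelfIdentifying other _∈N?_ SI@(ne , separating) = nonempty surjective ne , separating′
      where
      separating′ : ∀ u v → u ≢ v → ∃ λ w → InI H C′ u w × ¬ InI H C′ v w
      separating′ u v u≢v with φ u ≟ φ v
      ... | no φu≢φv = separation-lift (separating (φ u) (φ v) φu≢φv)
      ... | yes φu≡φv with dominated (isSelfIdentifying⇒dominating G C other SI) u
      ...   | w , w∈I[u] with (w ∈N? v) ×-dec (C′ w ≟ᵇ true)
      ...     | yes w∈I[v] = fibre-separating u≢v φu≡φv w∈I[u] w∈I[v]
      ...     | no w∉I[v] = w , w∈I[u] , w∉I[v]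

module Covering (e n : ℕ) .{{_ : NonZero n}} (n-large : 2 ℕ.* (3 ℕ.+ e ℕ.+ 1) ℕ.≤ n) where
  open import Data.Integer using (+_; -[1+_]; _+_; _*_; _-_; -_; ∣_∣)
  open import Data.Nat using (_∸_)
  open Congruence n

  d : ℕ
  d = 3 ℕ.+ e

  Cₙ : Graph
  Cₙ = Circulant n (1 ∷ (d ∸ 1) ∷ d ∷ (d ℕ.+ 1) ∷ [])

  infix 4 _∈C_
  _∈C_ : Fin n → Fin n → Set
  _∈C_ = _∈N[_] Cₙ

  D : ℤ
  D = + d

  ψ : ℤ × ℤ → ℤ
  ψ (x , y) = y + D * x

  φ : ℤ × ℤ → Fin n
  φ u = reduce (ψ u)

  δ : Offset → ℤ
  δ (a , b) = ⟦ b ⟧ + D * ⟦ a ⟧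

  ψ-⊕ : ∀ u s → ψ (u ⊕ s) ≡ ψ u + δ s
  ψ-⊕ (x , y) (a , b) = regroup x y ⟦ a ⟧ ⟦ b ⟧ D
    where
    regroup : ∀ x y p q D → (y + q) + D * (x + p) ≡ (y + D * x) + (q + D * p)
    regroup = solve-∀

  -- δ in the literal form in which CircAdj lists the steps ±1, ±(d ∸ 1), ±d, ±(d + 1).
  generator : Offset → ℤ
  generator (0ₛ , b) = ⟦ b ⟧
  generator (+1ₛ , -1ₛ) = + (d ∸ 1)
  generator (-1ₛ , +1ₛ) = - + (d ∸ 1)
  generator (+1ₛ , 0ₛ) = + d
  generator (-1ₛ , 0ₛ) = - + d
  generator (+1ₛ , +1ₛ) = + (d ℕ.+ 1)
  generator (-1ₛ , -1ₛ) = - + (d ℕ.+ 1)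

  private
    east : ∀ b D → b + D * + 1 ≡ D + b
    east = solve-∀
    west : ∀ b D → b + D * - + 1 ≡ - (D - b)
    west = solve-∀

  δ≡generator : ∀ s → δ s ≡ generator s
  δ≡generator (0ₛ , b) = trans (cong (λ k → ⟦ b ⟧ + k) (ℤP.*-zeroʳ D)) (ℤP.+-identityʳ ⟦ b ⟧)
  δ≡generator (+1ₛ , -1ₛ) = east ⟦ -1ₛ ⟧ D
  δ≡generator (+1ₛ , 0ₛ) = trans (east ⟦ 0ₛ ⟧ D) (ℤP.+-identityʳ D)
  δ≡generator (+1ₛ , +1ₛ) = east ⟦ +1ₛ ⟧ D
  δ≡generator (-1ₛ , -1ₛ) = west ⟦ -1ₛ ⟧ D
  δ≡generator (-1ₛ , 0ₛ) = trans (west ⟦ 0ₛ ⟧ D) (cong -_ (ℤP.+-identityʳ D))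
  δ≡generator (-1ₛ , +1ₛ) = west ⟦ +1ₛ ⟧ D

  ∈C⇒generator : ∀ {z x} → z ∈C x → Σ Offset λ s → + toℕ z ≈ + toℕ x + generator s
  ∈C⇒generator {z} (inj₁ refl) = (0ₛ , 0ₛ) , ≈-reflexive (sym (ℤP.+-identityʳ (+ toℕ z)))
  ∈C⇒generator (inj₂ (inj₁ h)) = (0ₛ , +1ₛ) , mod h
  ∈C⇒generator (inj₂ (inj₂ (inj₁ h))) = (0ₛ , -1ₛ) , mod h
  ∈C⇒generator (inj₂ (inj₂ (inj₂ (inj₁ h)))) = (+1ₛ , -1ₛ) , mod h
  ∈C⇒generator (inj₂ (inj₂ (inj₂ (inj₂ (inj₁ h))))) = (-1ₛ , +1ₛ) , mod h
  ∈C⇒generator (inj₂ (inj₂ (inj₂ (inj₂ (inj₂ (inj₁ h)))))) = (+1ₛ , 0ₛ) , mod h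
  ∈C⇒generator (inj₂ (inj₂ (inj₂ (inj₂ (inj₂ (inj₂ (inj₁ h))))))) = (-1ₛ , 0ₛ) , mod h
  ∈C⇒generator (inj₂ (inj₂ (inj₂ (inj₂ (inj₂ (inj₂ (inj₂ (inj₁ h)))))))) = (+1ₛ , +1ₛ) , mod h
  ∈C⇒generator (inj₂ (inj₂ (inj₂ (inj₂ (inj₂ (inj₂ (inj₂ (inj₂ (inj₁ h))))))))) = (-1ₛ , -1ₛ) , mod h

  generator⇒∈C : ∀ {z x} s → + toℕ z ≈ + toℕ x + generator s → z ∈C x
  generator⇒∈C {z} {x} (0ₛ , 0ₛ) h = inj₁ (toℕ-≈-injective (≈-trans h (≈-reflexive (ℤP.+-identityʳ (+ toℕ x)))))
  generator⇒∈C (0ₛ , +1ₛ) (mod h) = inj₂ (inj₁ h)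
  generator⇒∈C (0ₛ , -1ₛ) (mod h) = inj₂ (inj₂ (inj₁ h))
  generator⇒∈C (+1ₛ , -1ₛ) (mod h) = inj₂ (inj₂ (inj₂ (inj₁ h)))
  generator⇒∈C (-1ₛ , +1ₛ) (mod h) = inj₂ (inj₂ (inj₂ (inj₂ (inj₁ h))))
  generator⇒∈C (+1ₛ , 0ₛ) (mod h) = inj₂ (inj₂ (inj₂ (inj₂ (inj₂ (inj₁ h)))))
  generator⇒∈C (-1ₛ , 0ₛ) (mod h) = inj₂ (inj₂ (inj₂ (inj₂ (inj₂ (inj₂ (inj₁ h))))))
  generator⇒∈C (+1ₛ , +1ₛ) (mod h) = inj₂ (inj₂ (inj₂ (inj₂ (inj₂ (inj₂ (inj₂ (inj₁ h)))))))
  generator⇒∈C (-1ₛ , -1ₛ) (mod h) = inj₂ (inj₂ (inj₂ (inj₂ (inj₂ (inj₂ (inj₂ (inj₂ (inj₁ h))))))))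

  φ-⊕-≈ : ∀ u s → ψ (u ⊕ s) ≈ + toℕ (φ u) + δ s
  φ-⊕-≈ u s = begin
      ψ (u ⊕ s)               ≡⟨ ψ-⊕ u s ⟩
      ψ u + δ s               ≈⟨ ≈-+ʳ (δ s) (reduce-≈ (ψ u)) ⟨
      + toℕ (φ u) + δ s       ∎
    where open ≈-Reasoning

  φ-∈N : ∀ {w u} → w ∈K u → φ w ∈C φ u
  φ-∈N {w} {u} w∈u with ∈K⇒⊕ {w} {u} w∈u
  ... | s , refl = generator⇒∈C s (begin
      + toℕ (φ (u ⊕ s))         ≈⟨ reduce-≈ (ψ (u ⊕ s)) ⟩
      ψ (u ⊕ s)                 ≈⟨ φ-⊕-≈ u s ⟩
      + toℕ (φ u) + δ s         ≡⟨ cong (λ k → + toℕ (φ u) + k) (δ≡generator s) ⟩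
      + toℕ (φ u) + generator s ∎)
    where open ≈-Reasoning

  φ-lift-∈N : ∀ {z u} → z ∈C φ u → Σ (ℤ × ℤ) λ w → w ∈K u × φ w ≡ z
  φ-lift-∈N {z} {u} z∈ with ∈C⇒generator {z} {φ u} z∈
  ... | s , h = u ⊕ s , ⊕-∈K u s , reduce-unique (begin
      + toℕ z                     ≈⟨ h ⟩
      + toℕ (φ u) + generator s   ≡⟨ cong (λ k → + toℕ (φ u) + k) (δ≡generator s) ⟨
      + toℕ (φ u) + δ s           ≈⟨ φ-⊕-≈ u s ⟨
      ψ (u ⊕ s)                   ∎)
    where open ≈-Reasoning

  δᵍ : Gap × Gap → ℤ
  δᵍ (A , B) = ⟦ B ⟧ᵍ + D * ⟦ A ⟧ᵍ

  δ-difference : ∀ a b a' b' → δ (a , b) - δ (a' , b') ≡ δᵍ (a ⊖ a' , b ⊖ b')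
  δ-difference a b a' b' = begin
      δ (a , b) - δ (a' , b')                                 ≡⟨ regroup ⟦ a ⟧ ⟦ b ⟧ ⟦ a' ⟧ ⟦ b' ⟧ D ⟩
      (⟦ b ⟧ - ⟦ b' ⟧) + D * (⟦ a ⟧ - ⟦ a' ⟧)                 ≡⟨ cong₂ (λ p q → p + D * q) (⟦⊖⟧ b b') (⟦⊖⟧ a a') ⟨
      δᵍ (a ⊖ a' , b ⊖ b')                                    ∎
    where
    open ≡-Reasoning
    regroup : ∀ a b a' b' D → (b + D * a) - (b' + D * a') ≡ (b - b') + D * (a - a')
    regroup = solve-∀

  private
    8+2e≤n : 8 ℕ.+ (e ℕ.+ e) ℕ.≤ n
    8+2e≤n = subst (ℕ._≤ n) (expand e) n-large
      where
      expand : ∀ e → 2 ℕ.* (3 ℕ.+ e ℕ.+ 1) ≡ 8 ℕ.+ (e ℕ.+ e)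
      expand = ℕSolver.solve-∀

    k+2e<n : ∀ k → {T (k ℕ.≤ᵇ 7)} → k ℕ.+ (e ℕ.+ e) ℕ.< n
    k+2e<n k {k≤7} = ℕP.<-≤-trans (ℕP.+-monoˡ-< (e ℕ.+ e) (ℕ.s≤s (ℕP.≤ᵇ⇒≤ k 7 k≤7))) 8+2e≤n

    k+e<n : ∀ k → {T (k ℕ.≤ᵇ 7)} → k ℕ.+ e ℕ.< n
    k+e<n k {k≤7} = ℕP.≤-<-trans (ℕP.+-monoʳ-≤ k (ℕP.m≤n+m e e)) (k+2e<n k {k≤7})

    k<n : ∀ k → {T (k ℕ.≤ᵇ 7)} → k ℕ.< n
    k<n k {k≤7} = ℕP.≤-<-trans (ℕP.m≤m+n k (e ℕ.+ e)) (k+2e<n k {k≤7})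

    rewriteˡ : ∀ {a a' b} → a ≡ a' → a ≈ b → a' ≈ b
    rewriteˡ refl h = h

    row₋₂ : ∀ B → δᵍ (-2ᵍ , B) ≡ - ((+ 6 - ⟦ B ⟧ᵍ) + (+ e + + e))
    row₋₂ B = ring ⟦ B ⟧ᵍ (+ e)
      where
      ring : ∀ B E → B + (+ 3 + E) * - + 2 ≡ - ((+ 6 - B) + (E + E))
      ring = solve-∀

    row₋₁ : ∀ B → δᵍ (-1ᵍ , B) ≡ - ((+ 3 - ⟦ B ⟧ᵍ) + + e)
    row₋₁ B = ring ⟦ B ⟧ᵍ (+ e)
      where
      ring : ∀ B E → B + (+ 3 + E) * - + 1 ≡ - ((+ 3 - B) + E)
      ring = solve-∀

    row₀ : ∀ B → δᵍ (0ᵍ , B) ≡ ⟦ B ⟧ᵍ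
    row₀ B = trans (cong (λ k → ⟦ B ⟧ᵍ + k) (ℤP.*-zeroʳ D)) (ℤP.+-identityʳ ⟦ B ⟧ᵍ)

    row₊₁ : ∀ B → δᵍ (+1ᵍ , B) ≡ (⟦ B ⟧ᵍ + + 3) + + e
    row₊₁ B = ring ⟦ B ⟧ᵍ (+ e)
      where
      ring : ∀ B E → B + (+ 3 + E) * + 1 ≡ (B + + 3) + E
      ring = solve-∀

    row₊₂ : ∀ B → δᵍ (+2ᵍ , B) ≡ (⟦ B ⟧ᵍ + + 6) + (+ e + + e)
    row₊₂ B = ring ⟦ B ⟧ᵍ (+ e)
      where
      ring : ∀ B E → B + (+ 3 + E) * + 2 ≡ (B + + 6) + (E + E)
      ring = solve-∀

  -- Every displacement other than 0 and ±(2,2) has 0 < |δᵍ| < n (as d ≥ 3 and n ≥ 2d + 2);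
  -- ±(2,2) gives ±(2d + 2), which is a multiple of n when n = 2d + 2.
  δᵍ-≈0 : ∀ A B → δᵍ (A , B) ≈ + 0 → (A ≡ 0ᵍ × B ≡ 0ᵍ) ⊎ (A ≡ +2ᵍ × B ≡ +2ᵍ) ⊎ (A ≡ -2ᵍ × B ≡ -2ᵍ)
  δᵍ-≈0 0ᵍ 0ᵍ _ = inj₁ (refl , refl)
  δᵍ-≈0 +2ᵍ +2ᵍ _ = inj₂ (inj₁ (refl , refl))
  δᵍ-≈0 -2ᵍ -2ᵍ _ = inj₂ (inj₂ (refl , refl))
  δᵍ-≈0 -2ᵍ -1ᵍ h = ⊥-elim (-[1+]≉0 (k+2e<n 7) (rewriteˡ (row₋₂ -1ᵍ) h))
  δᵍ-≈0 -2ᵍ 0ᵍ h = ⊥-elim (-[1+]≉0 (k+2e<n 6) (rewriteˡ (row₋₂ 0ᵍ) h))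
  δᵍ-≈0 -2ᵍ +1ᵍ h = ⊥-elim (-[1+]≉0 (k+2e<n 5) (rewriteˡ (row₋₂ +1ᵍ) h))
  δᵍ-≈0 -2ᵍ +2ᵍ h = ⊥-elim (-[1+]≉0 (k+2e<n 4) (rewriteˡ (row₋₂ +2ᵍ) h))
  δᵍ-≈0 -1ᵍ -2ᵍ h = ⊥-elim (-[1+]≉0 (k+e<n 5) (rewriteˡ (row₋₁ -2ᵍ) h))
  δᵍ-≈0 -1ᵍ -1ᵍ h = ⊥-elim (-[1+]≉0 (k+e<n 4) (rewriteˡ (row₋₁ -1ᵍ) h))
  δᵍ-≈0 -1ᵍ 0ᵍ h = ⊥-elim (-[1+]≉0 (k+e<n 3) (rewriteˡ (row₋₁ 0ᵍ) h))
  δᵍ-≈0 -1ᵍ +1ᵍ h = ⊥-elim (-[1+]≉0 (k+e<n 2) (rewriteˡ (row₋₁ +1ᵍ) h))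
  δᵍ-≈0 -1ᵍ +2ᵍ h = ⊥-elim (-[1+]≉0 (k+e<n 1) (rewriteˡ (row₋₁ +2ᵍ) h))
  δᵍ-≈0 0ᵍ -2ᵍ h = ⊥-elim (-[1+]≉0 (k<n 2) (rewriteˡ (row₀ -2ᵍ) h))
  δᵍ-≈0 0ᵍ -1ᵍ h = ⊥-elim (-[1+]≉0 (k<n 1) (rewriteˡ (row₀ -1ᵍ) h))
  δᵍ-≈0 0ᵍ +1ᵍ h = ⊥-elim (+[1+]≉0 (k<n 1) (rewriteˡ (row₀ +1ᵍ) h))
  δᵍ-≈0 0ᵍ +2ᵍ h = ⊥-elim (+[1+]≉0 (k<n 2) (rewriteˡ (row₀ +2ᵍ) h))
  δᵍ-≈0 +1ᵍ -2ᵍ h = ⊥-elim (+[1+]≉0 (k+e<n 1) (rewriteˡ (row₊₁ -2ᵍ) h))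
  δᵍ-≈0 +1ᵍ -1ᵍ h = ⊥-elim (+[1+]≉0 (k+e<n 2) (rewriteˡ (row₊₁ -1ᵍ) h))
  δᵍ-≈0 +1ᵍ 0ᵍ h = ⊥-elim (+[1+]≉0 (k+e<n 3) (rewriteˡ (row₊₁ 0ᵍ) h))
  δᵍ-≈0 +1ᵍ +1ᵍ h = ⊥-elim (+[1+]≉0 (k+e<n 4) (rewriteˡ (row₊₁ +1ᵍ) h))
  δᵍ-≈0 +1ᵍ +2ᵍ h = ⊥-elim (+[1+]≉0 (k+e<n 5) (rewriteˡ (row₊₁ +2ᵍ) h))
  δᵍ-≈0 +2ᵍ -2ᵍ h = ⊥-elim (+[1+]≉0 (k+2e<n 4) (rewriteˡ (row₊₂ -2ᵍ) h))
  δᵍ-≈0 +2ᵍ -1ᵍ h = ⊥-elim (+[1+]≉0 (k+2e<n 5) (rewriteˡ (row₊₂ -1ᵍ) h))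
  δᵍ-≈0 +2ᵍ 0ᵍ h = ⊥-elim (+[1+]≉0 (k+2e<n 6) (rewriteˡ (row₊₂ 0ᵍ) h))
  δᵍ-≈0 +2ᵍ +1ᵍ h = ⊥-elim (+[1+]≉0 (k+2e<n 7) (rewriteˡ (row₊₂ +1ᵍ) h))

  δ-≈ : ∀ s s' → δ s ≈ δ s' → s ≡ s' ⊎ Antipodal s s'
  δ-≈ (a , b) (a' , b') h =
    gaps⇒offsets a b a' b' (δᵍ-≈0 (a ⊖ a') (b ⊖ b') (rewriteˡ (δ-difference a b a' b') (≈⇒-≈0 h)))

  offsets-≈ : ∀ {u v} s s' → φ u ≡ φ v → u ⊕ s ≡ v ⊕ s' → δ s ≈ δ s'
  offsets-≈ {u} {v} s s' φu≡φv eq = ≈-+-cancelˡ {ψ u} {ψ v} (reduce-injective φu≡φv) (≈-reflexive (begin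
      ψ u + δ s      ≡⟨ ψ-⊕ u s ⟨
      ψ (u ⊕ s)      ≡⟨ cong ψ eq ⟩
      ψ (v ⊕ s')     ≡⟨ ψ-⊕ v s' ⟩
      ψ v + δ s'     ∎))
    where open ≡-Reasoning

  φ-⊕-cong : ∀ u s s' → δ s ≈ δ s' → φ (u ⊕ s) ≡ φ (u ⊕ s')
  φ-⊕-cong u s s' δs≈δs' = reduce-cong (begin
      ψ (u ⊕ s)      ≡⟨ ψ-⊕ u s ⟩
      ψ u + δ s      ≈⟨ ≈-+ˡ (ψ u) δs≈δs' ⟩
      ψ u + δ s'     ≡⟨ ψ-⊕ u s' ⟨
      ψ (u ⊕ s')     ∎)
    where open ≈-Reasoning

  φ-surjective : ∀ z → Σ (ℤ × ℤ) λ u → φ u ≡ z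
  φ-surjective z = (+ 0 , + toℕ z) , reduce-unique (≈-reflexive (sym (trans (cong (λ k → + toℕ z + k) (ℤP.*-zeroʳ D)) (ℤP.+-identityʳ (+ toℕ z)))))

  -- Distinct vertices of one fibre sharing a neighbour w sit antipodally around w,
  -- and the antipode of w in N[u] lies in the fibre of w but outside N[v].
  antipode-codeword : (C : Fin n → Bool) → ∀ {u v w} → u ≢ v → φ u ≡ φ v →
                      Σ Offset (λ s → w ≡ u ⊕ s) → Σ Offset (λ s' → w ≡ v ⊕ s') → C (φ w) ≡ true →
                      Σ (ℤ × ℤ) λ w' → InI KingGrid (C ∘ φ) u w' × ¬ InI KingGrid (C ∘ φ) v w'
  antipode-codeword C {u} {v} u≢v φu≡φv (s , refl) (s' , eq) Cw =
    [ (λ { refl → ⊥-elim (u≢v (⊕-cancelʳ {u} {v} s eq)) })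
    , (λ antipodal → u ⊕ s' , (⊕-∈K u s' , trans (cong C (φ-⊕-cong u s' s (≈-sym δs≈δs'))) Cw) ,
                     antipodal-apart {u} {v} {s} {s'} antipodal eq ∘ proj₁)
    ]′ (δ-≈ s s' δs≈δs')
    where
    δs≈δs' : δ s ≈ δ s'
    δs≈δs' = offsets-≈ {u} {v} s s' φu≡φv eq

  module φ-Pullback = Pullback KingGrid Cₙ φ (λ {w} {u} → φ-∈N {w} {u}) (λ {z} {u} → φ-lift-∈N {z} {u})

  fibre-separating : (C : Fin n → Bool) → φ-Pullback.FibreSeparating C
  fibre-separating C {u} {v} {w} u≢v φu≡φv (w∈u , Cw) (w∈v , _) =
    antipode-codeword C u≢v φu≡φv (∈K⇒⊕ {w} {u} w∈u) (∈K⇒⊕ {w} {v} w∈v) Cw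

module Fractions where
  open import Data.Nat using (zero; suc; _≤_; _+_; _*_)
  open import Data.Integer using (+_; -[1+_])
  open import Data.Rational as ℚ using (ℚ; mkℚ; _/_; toℚᵘ)
  import Data.Rational.Properties as ℚP
  open import Data.Rational.Unnormalised as ℚᵘ using (mkℚᵘ; *≤*)
  import Data.Rational.Unnormalised.Properties as ℚᵘP

  toℚᵘ-/ : ∀ i n .{{_ : NonZero n}} → toℚᵘ (i / n) ℚᵘ.≃ (i ℚᵘ./ n)
  toℚᵘ-/ i (suc m) = ℚP.toℚᵘ-fromℚᵘ (mkℚᵘ i m)

  /≤/+/ : ∀ a A b B p Q .{{_ : NonZero A}} .{{_ : NonZero B}} .{{_ : NonZero Q}} →
          a * (B * Q) ≤ (b * Q + p * B) * A → (+ a) / A ℚ.≤ (+ b) / B ℚ.+ (+ p) / Q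
  /≤/+/ a A@(suc _) b B@(suc _) p Q@(suc _) h = ℚP.toℚᵘ-cancel-≤ (begin
      toℚᵘ ((+ a) / A)                                 ≃⟨ toℚᵘ-/ (+ a) A ⟩
      (+ a) ℚᵘ./ A                                     ≤⟨ *≤* (subst₂ ℤ._≤_ lhs rhs (ℤ.+≤+ h)) ⟩
      (+ b) ℚᵘ./ B ℚᵘ.+ (+ p) ℚᵘ./ Q                   ≃⟨ ℚᵘP.+-cong (toℚᵘ-/ (+ b) B) (toℚᵘ-/ (+ p) Q) ⟨
      toℚᵘ ((+ b) / B) ℚᵘ.+ toℚᵘ ((+ p) / Q)           ≃⟨ ℚP.toℚᵘ-homo-+ ((+ b) / B) ((+ p) / Q) ⟨
      toℚᵘ ((+ b) / B ℚ.+ (+ p) / Q)                   ∎)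
    where
    open ℚᵘP.≤-Reasoning
    lhs : + (a * (B * Q)) ≡ + a ℤ.* + (B * Q)
    lhs = ℤP.pos-* a (B * Q)
    rhs : + ((b * Q + p * B) * A) ≡ (+ b ℤ.* + Q ℤ.+ + p ℤ.* + B) ℤ.* + A
    rhs = trans (ℤP.pos-* (b * Q + p * B) A)
                (cong (ℤ._* + A) (trans (ℤP.pos-+ (b * Q) (p * B)) (cong₂ ℤ._+_ (ℤP.pos-* b Q) (ℤP.pos-* p B))))

  ≤+⇒-≤ : ∀ {p q r} → p ℚ.≤ q ℚ.+ r → p ℚ.- r ℚ.≤ q
  ≤+⇒-≤ {p} {q} {r} p≤q+r = begin
      p ℚ.- r               ≤⟨ ℚP.+-monoˡ-≤ (ℚ.- r) p≤q+r ⟩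
      (q ℚ.+ r) ℚ.- r       ≡⟨ ℚP.+-assoc q r (ℚ.- r) ⟩
      q ℚ.+ (r ℚ.- r)       ≡⟨ cong (q ℚ.+_) (ℚP.+-inverseʳ r) ⟩
      q ℚ.+ ℚ.0ℚ            ≡⟨ ℚP.+-identityʳ q ⟩
      q                     ∎
    where open ℚP.≤-Reasoning

  side : ℕ → ℕ
  side m = suc (2 * m)

  sizeQ≡side² : ∀ m → sizeQ m ≡ side m * side m
  sizeQ≡side² m = square m
    where
    square : ∀ m → 1 + 4 * m * (1 + m) ≡ (1 + 2 * m) * (1 + 2 * m)
    square = ℕSolver.solve-∀

  m≤side : ∀ m → m ≤ side m
  m≤side m = ℕP.≤-trans (ℕP.m≤m+n m (m + 0)) (ℕP.n≤1+n (2 * m))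

  density-from-discrepancy : ∀ (C : ℤ × ℤ → Bool) n k B .{{_ : NonZero n}} →
    (∀ m → n * countQ C m ≤ k * sizeQ m + B * side m) →
    (∀ m → k * sizeQ m ≤ n * countQ C m + B * side m) →
    HasDensity C ((+ k) / n)
  density-from-discrepancy C n k B upper lower = above , below
    where
    -- Once B·Q ≤ side m, the boundary term B · side m is at most ε · n · sizeQ m for ε = P/Q,
    -- which fixes the threshold M = B·Q.
    slack : ∀ {m} p q → B * suc q ≤ side m → B * side m * suc q ≤ suc p * n * sizeQ m
    slack {m} p q Bq≤L = begin
      B * L * suc q          ≡⟨ swap B L (suc q) ⟩
      B * suc q * L          ≤⟨ ℕP.*-monoˡ-≤ L Bq≤L ⟩
      L * L                    ≡⟨ sizeQ≡side² m ⟨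
      sizeQ m                    ≤⟨ ℕP.m≤n*m (sizeQ m) (suc p * n) {{ℕP.m*n≢0 (suc p) n}} ⟩
      suc p * n * sizeQ m    ∎
      where
      open ℕP.≤-Reasoning
      L = side m
      swap : ∀ a b c → a * b * c ≡ a * c * b
      swap = ℕSolver.solve-∀

    above : ∀ ε → ℚ.Positive ε → ∃ λ M → ∀ m → M ≤ m → ratioQ C m ℚ.≤ (+ k) / n ℚ.+ ε
    above ε@(mkℚ (+ suc p) q _) _ = B * suc q , λ m M≤m →
      subst (λ ε → ratioQ C m ℚ.≤ (+ k) / n ℚ.+ ε) (ℚP.↥p/↧p≡p ε)
        (/≤/+/ (countQ C m) (sizeQ m) k n (suc p) (suc q) (chain m (ℕP.≤-trans M≤m (m≤side m))))
      where
      chain : ∀ m → B * suc q ≤ side m →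
              countQ C m * (n * suc q) ≤ (k * suc q + suc p * n) * sizeQ m
      chain m Bq≤L = begin
        N * (n * Q)                                ≡⟨ e₁ N n Q ⟩
        (n * N) * Q                                ≤⟨ ℕP.*-monoˡ-≤ Q (upper m) ⟩
        (k * S + B * side m) * Q               ≡⟨ e₂ k S B (side m) Q ⟩
        k * Q * S + B * side m * Q           ≤⟨ ℕP.+-monoʳ-≤ (k * Q * S) (slack {m} p q Bq≤L) ⟩
        k * Q * S + suc p * n * S            ≡⟨ ℕP.*-distribʳ-+ S (k * Q) (suc p * n) ⟨
        (k * Q + suc p * n) * S                ∎
        where
        open ℕP.≤-Reasoning
        N = countQ C m
        S = sizeQ m
        Q = suc q
        e₁ : ∀ N n Q → N * (n * Q) ≡ (n * N) * Q
        e₁ = ℕSolver.solve-∀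
        e₂ : ∀ k S B L Q → (k * S + B * L) * Q ≡ k * Q * S + B * L * Q
        e₂ = ℕSolver.solve-∀

    below : ∀ ε → ℚ.Positive ε → ∀ M → ∃ λ m → M ≤ m × (+ k) / n ℚ.- ε ℚ.≤ ratioQ C m
    below ε@(mkℚ (+ suc p) q _) _ M = m , ℕP.m≤m+n M (B * suc q) ,
      ≤+⇒-≤ (subst (λ ε → (+ k) / n ℚ.≤ ratioQ C m ℚ.+ ε) (ℚP.↥p/↧p≡p ε)
        (/≤/+/ k n (countQ C m) (sizeQ m) (suc p) (suc q) chain))
      where
      m = M + B * suc q
      chain : k * (sizeQ m * suc q) ≤ (countQ C m * suc q + suc p * sizeQ m) * n
      chain = begin
        k * (S * Q)                                ≡⟨ ℕP.*-assoc k S Q ⟨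
        (k * S) * Q                                ≤⟨ ℕP.*-monoˡ-≤ Q (lower m) ⟩
        (n * N + B * side m) * Q               ≡⟨ ℕP.*-distribʳ-+ Q (n * N) (B * side m) ⟩
        n * N * Q + B * side m * Q           ≤⟨ ℕP.+-monoʳ-≤ (n * N * Q) (slack {m} p q Bq≤L) ⟩
        n * N * Q + suc p * n * S            ≡⟨ e N Q (suc p) S n ⟩
        (N * Q + suc p * S) * n                ∎
        where
        open ℕP.≤-Reasoning
        N = countQ C m
        S = sizeQ m
        Q = suc q
        Bq≤L : B * suc q ≤ side m
        Bq≤L = ℕP.≤-trans (ℕP.m≤n+m (B * suc q) M) (m≤side m)
        e : ∀ N Q P S n → n * N * Q + P * n * S ≡ (N * Q + P * S) * n
        e = ℕSolver.solve-∀

open Fractions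

module Windows where
  open import Data.Nat using (zero; suc; _≤_; _<_; _+_; _*_; z≤n)
  open import Data.Nat.DivMod using (_%_; _/_; m≡m%n+[m/n]*n; m%n<n)
  open import Data.Nat.ListAction using (sum)
  open import Data.Nat.ListAction.Properties using (sum-++)
  open import Data.List using (map; applyUpTo; tabulate; concatMap; length)
  import Data.Fin as F

  ∑< : ℕ → (ℕ → ℕ) → ℕ
  ∑< L f = sum (applyUpTo f L)

  ∑<-cong : ∀ L {f g} → (∀ i → f i ≡ g i) → ∑< L f ≡ ∑< L g
  ∑<-cong zero _ = refl
  ∑<-cong (suc L) f≗g = cong₂ _+_ (f≗g 0) (∑<-cong L (f≗g ∘ suc))

  ∑<-+ : ∀ a b f → ∑< (a + b) f ≡ ∑< a f + ∑< b (λ i → f (a + i))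
  ∑<-+ zero b f = refl
  ∑<-+ (suc a) b f = trans (cong (λ s → f 0 + s) (∑<-+ a b (f ∘ suc))) (sym (ℕP.+-assoc (f 0) _ _))

  ∑<-≤ : ∀ L {f} → (∀ i → f i ≤ 1) → ∑< L f ≤ L
  ∑<-≤ zero _ = z≤n
  ∑<-≤ (suc L) f≤1 = ℕP.+-mono-≤ (f≤1 0) (∑<-≤ L (f≤1 ∘ suc))

  sum-tabulate : ∀ m (h : Fin m → ℕ) f → (∀ j → f (toℕ j) ≡ h j) → sum (tabulate h) ≡ ∑< m f
  sum-tabulate zero h f eq = refl
  sum-tabulate (suc m) h f eq = cong₂ _+_ (sym (eq F.zero)) (sum-tabulate m (h ∘ F.suc) (f ∘ suc) (eq ∘ F.suc))

  sum-concatMap : ∀ {A : Set} (F : A → List ℕ) xs → sum (concatMap F xs) ≡ sum (map (sum ∘ F) xs)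
  sum-concatMap F [] = refl
  sum-concatMap F (x ∷ xs) = trans (sum-++ (F x) (concatMap F xs)) (cong (λ s → sum (F x) + s) (sum-concatMap F xs))

  *-sum-≤ : ∀ {A : Set} n (f : A → ℕ) {B} xs → (∀ x → n * f x ≤ B) → n * sum (map f xs) ≤ length xs * B
  *-sum-≤ n f [] _ = ℕP.≤-reflexive (ℕP.*-zeroʳ n)
  *-sum-≤ n f {B} (x ∷ xs) bound =
    subst (_≤ B + length xs * B) (sym (ℕP.*-distribˡ-+ n (f x) _)) (ℕP.+-mono-≤ (bound x) (*-sum-≤ n f xs bound))

  ≤-*-sum : ∀ {A : Set} n (f : A → ℕ) {B E} xs → (∀ x → B ≤ n * f x + E) →
            length xs * B ≤ n * sum (map f xs) + length xs * E
  ≤-*-sum n f [] _ = z≤n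
  ≤-*-sum n f {B} {E} (x ∷ xs) bound =
    subst (B + length xs * B ≤_) (regroup n (f x) (sum (map f xs)) E (length xs * E))
      (ℕP.+-mono-≤ (bound x) (≤-*-sum n f xs bound))
    where
    regroup : ∀ n a s E lE → (n * a + E) + (n * s + lE) ≡ n * (a + s) + (E + lE)
    regroup = ℕSolver.solve-∀

  module PeriodicWindow (n : ℕ) .{{_ : NonZero n}} (P : ℕ → ℕ)
    (periodic : ∀ i → P (i + n) ≡ P i) (P≤1 : ∀ i → P i ≤ 1) where

    window : ℕ → ℕ → ℕ
    window c L = ∑< L (λ i → P (c + i))

    k : ℕ
    k = window 0 n

    window-+ : ∀ c a b → window c (a + b) ≡ window c a + window (c + a) b
    window-+ c a b = trans (∑<-+ a b (λ i → P (c + i))) (cong (λ w → window c a + w) (∑<-cong b (λ i → cong P (sym (ℕP.+-assoc c a i)))))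

    window-suc : ∀ c → window (suc c) n ≡ window c n
    window-suc c = ℕP.+-cancelˡ-≡ (P c) _ _ (begin
        P c + window (suc c) n              ≡⟨ cong₂ _+_ (cong P (sym (ℕP.+-identityʳ c))) (∑<-cong n (λ i → cong P (sym (ℕP.+-suc c i)))) ⟩
        window c (suc n)                    ≡⟨ cong (window c) (ℕP.+-comm 1 n) ⟩
        window c (n + 1)                    ≡⟨ window-+ c n 1 ⟩
        window c n + (P (c + n + 0) + 0)    ≡⟨ cong (λ w → window c n + w) (trans (ℕP.+-identityʳ _) (trans (cong P (ℕP.+-identityʳ (c + n))) (periodic c))) ⟩
        window c n + P c                    ≡⟨ ℕP.+-comm (window c n) (P c) ⟩
        P c + window c n                    ∎)
      where open ≡-Reasoning

    window-period : ∀ c → window c n ≡ k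
    window-period zero = refl
    window-period (suc c) = trans (window-suc c) (window-period c)

    window-periods : ∀ c q → window c (q * n) ≡ q * k
    window-periods c zero = refl
    window-periods c (suc q) = trans (window-+ c n (q * n)) (cong₂ _+_ (window-period c) (window-periods (c + n) q))

    window-split : ∀ c L → window c L ≡ window c (L % n) + (L / n) * k
    window-split c L = trans (cong (window c) (m≡m%n+[m/n]*n L n))
                             (trans (window-+ c (L % n) ((L / n) * n)) (cong (λ w → window c (L % n) + w) (window-periods (c + L % n) (L / n))))

    window-leftover< : ∀ c L → window c (L % n) < n
    window-leftover< c L = ℕP.≤-<-trans (∑<-≤ (L % n) (λ i → P≤1 (c + i))) (m%n<n L n)

    window-upper : ∀ c L → n * window c L ≤ L * k + n * n
    window-upper c L = begin
        n * window c L                                  ≡⟨ cong (n *_) (window-split c L) ⟩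
        n * (window c r + q * k)                        ≡⟨ regroup n (window c r) q k ⟩
        n * window c r + (q * n) * k                    ≤⟨ ℕP.+-mono-≤ (ℕP.*-monoʳ-≤ n (ℕP.<⇒≤ (window-leftover< c L)))
                                                                       (ℕP.*-monoˡ-≤ k (subst (q * n ≤_) (sym (m≡m%n+[m/n]*n L n)) (ℕP.m≤n+m (q * n) r))) ⟩
        n * n + L * k                                   ≡⟨ ℕP.+-comm (n * n) (L * k) ⟩
        L * k + n * n                                   ∎
      where
      open ℕP.≤-Reasoning
      r = L % n
      q = L / n
      regroup : ∀ n w q k → n * (w + q * k) ≡ n * w + (q * n) * k
      regroup = ℕSolver.solve-∀

    window-lower : ∀ c L → L * k ≤ n * window c L + n * k
    window-lower c L = begin
        L * k                                           ≡⟨ cong (_* k) (m≡m%n+[m/n]*n L n) ⟩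
        (r + q * n) * k                                 ≡⟨ regroup r q n k ⟩
        r * k + n * (q * k)                             ≤⟨ ℕP.+-mono-≤ (ℕP.*-monoˡ-≤ k (ℕP.<⇒≤ (m%n<n L n))) (ℕP.*-monoʳ-≤ n (ℕP.m≤n+m (q * k) (window c r))) ⟩
        n * k + n * (window c r + q * k)                ≡⟨ cong (λ w → n * k + n * w) (window-split c L) ⟨
        n * k + n * window c L                          ≡⟨ ℕP.+-comm (n * k) (n * window c L) ⟩
        n * window c L + n * k                          ∎
      where
      open ℕP.≤-Reasoning
      r = L % n
      q = L / n
      regroup : ∀ r q n k → (r + q * n) * k ≡ r * k + n * (q * k)
      regroup = ℕSolver.solve-∀

open Windows

module LatticeCode (n : ℕ) .{{_ : NonZero n}} (C : Fin n → Bool) (D : ℤ) where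
  open import Data.Nat using (_≤_; _+_; _*_; z≤n)
  open import Data.Integer using (+_)
  import Data.Rational as ℚ
  open import Data.Nat.ListAction using (sum)
  open import Data.List using (map; upTo; length)
  import Data.List.Properties as LP
  open Congruence n

  code : ℤ × ℤ → Bool
  code (x , y) = C (reduce (y ℤ.+ D ℤ.* x))

  indicator : Fin n → ℕ
  indicator z = if C z then 1 else 0

  P : ℕ → ℕ
  P j = indicator (reduce (+ j))

  P-periodic : ∀ i → P (i + n) ≡ P i
  P-periodic i = cong indicator (reduce-cong {+ (i + n)} {+ i} (mod (+ 1 , trans (cong (ℤ._- + i) (ℤP.pos-+ i n)) (cancel (+ i) (+ n)))))
    where
    cancel : ∀ i n → i ℤ.+ n ℤ.- i ≡ + 1 ℤ.* n
    cancel = solve-∀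

  P≤1 : ∀ i → P i ≤ 1
  P≤1 i with C (reduce (+ i))
  ... | true = ℕP.≤-refl
  ... | false = z≤n

  open PeriodicWindow n P P-periodic P≤1

  codeSize≡k : codeSize n C ≡ k
  codeSize≡k = trans (cong sum (LP.map-tabulate id indicator)) (sum-tabulate n indicator P (cong indicator ∘ reduce-toℕ))

  row-start : ℕ → ℤ → ℕ
  row-start m x = toℕ (reduce (D ℤ.* x ℤ.- + m))

  row-start-≈ : ∀ m x i → + (row-start m x + i) ≈ (+ i ℤ.- + m) ℤ.+ D ℤ.* x
  row-start-≈ m x i = begin
      + (row-start m x + i)                       ≡⟨ ℤP.pos-+ (row-start m x) i ⟩
      + row-start m x ℤ.+ + i                     ≈⟨ ≈-+ʳ (+ i) (reduce-≈ (D ℤ.* x ℤ.- + m)) ⟩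
      (D ℤ.* x ℤ.- + m) ℤ.+ + i               ≡⟨ swap (D ℤ.* x) (+ m) (+ i) ⟩
      (+ i ℤ.- + m) ℤ.+ D ℤ.* x               ∎
    where
    open ≈-Reasoning
    swap : ∀ a m i → (a ℤ.- m) ℤ.+ i ≡ (i ℤ.- m) ℤ.+ a
    swap = solve-∀

  row-count : ∀ m x → sum (map (λ y → if code (x , y) then 1 else 0) (range m)) ≡ window (row-start m x) (side m)
  row-count m x = begin
      sum (map h (map f (upTo L)))          ≡⟨ cong sum (LP.map-∘ (upTo L)) ⟨
      sum (map (h ∘ f) (upTo L))            ≡⟨ cong sum (LP.map-upTo (h ∘ f) L) ⟩
      ∑< L (h ∘ f)                          ≡⟨ ∑<-cong L (λ i → cong indicator (reduce-cong (≈-sym (row-start-≈ m x i)))) ⟩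
      window (row-start m x) L                  ∎
    where
    open ≡-Reasoning
    L = side m
    f : ℕ → ℤ
    f i = + i ℤ.- + m
    h : ℤ → ℕ
    h y = if code (x , y) then 1 else 0

  length-range : ∀ m → length (range m) ≡ side m
  length-range m = trans (LP.length-map _ (upTo (side m))) (LP.length-upTo (side m))

  countQ-rows : ∀ m → countQ code m ≡ sum (map (λ x → window (row-start m x) (side m)) (range m))
  countQ-rows m = trans (sum-concatMap (λ x → map (λ y → if code (x , y) then 1 else 0) (range m)) (range m)) (cong sum (LP.map-cong (row-count m) (range m)))

  B : ℕ
  B = n * (n + k)

  discrepancy-upper : ∀ m → n * countQ code m ≤ k * sizeQ m + B * side m
  discrepancy-upper m = begin
      n * countQ code m                                   ≡⟨ cong (n *_) (countQ-rows m) ⟩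
      n * sum (map W (range m))                           ≤⟨ *-sum-≤ n W (range m) (λ x → window-upper (row-start m x) L) ⟩
      length (range m) * (L * k + n * n)                  ≡⟨ cong (_* (L * k + n * n)) (length-range m) ⟩
      L * (L * k + n * n)                                 ≡⟨ regroup L k n ⟩
      k * (L * L) + (n * n) * L                           ≤⟨ ℕP.+-monoʳ-≤ (k * (L * L)) (ℕP.*-monoˡ-≤ L (ℕP.*-monoʳ-≤ n (ℕP.m≤m+n n k))) ⟩
      k * (L * L) + B * L                                 ≡⟨ cong (λ S → k * S + B * L) (sizeQ≡side² m) ⟨
      k * sizeQ m + B * L                                 ∎
    where
    open ℕP.≤-Reasoning
    L = side m
    W = λ x → window (row-start m x) L
    regroup : ∀ L k n → L * (L * k + n * n) ≡ k * (L * L) + (n * n) * L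
    regroup = ℕSolver.solve-∀

  discrepancy-lower : ∀ m → k * sizeQ m ≤ n * countQ code m + B * side m
  discrepancy-lower m = begin
      k * sizeQ m                                         ≡⟨ cong (k *_) (sizeQ≡side² m) ⟩
      k * (L * L)                                         ≡⟨ regroup k L ⟩
      L * (L * k)                                         ≡⟨ cong (_* (L * k)) (length-range m) ⟨
      length (range m) * (L * k)                          ≤⟨ ≤-*-sum n W (range m) (λ x → window-lower (row-start m x) L) ⟩
      n * sum (map W (range m)) + length (range m) * (n * k)   ≡⟨ cong₂ (λ c l → n * c + l * (n * k)) (countQ-rows m) (sym (length-range m)) ⟨
      n * countQ code m + L * (n * k)                     ≤⟨ ℕP.+-monoʳ-≤ (n * countQ code m) (ℕP.*-monoʳ-≤ L (ℕP.*-monoʳ-≤ n (ℕP.m≤n+m k n))) ⟩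
      n * countQ code m + L * B                           ≡⟨ cong (λ b → n * countQ code m + b) (ℕP.*-comm L B) ⟩
      n * countQ code m + B * L                           ∎
    where
    open ℕP.≤-Reasoning
    L = side m
    W = λ x → window (row-start m x) L
    regroup : ∀ k L → k * (L * L) ≡ L * (L * k)
    regroup = ℕSolver.solve-∀

  code-density : HasDensity code ((+ codeSize n C) ℚ./ n)
  code-density = subst (λ c → HasDensity code ((+ c) ℚ./ n)) (sym codeSize≡k)
    (density-from-discrepancy code n k B discrepancy-upper discrepancy-lower)

open import Data.Nat using (ℕ; NonZero; _≤_; _+_; _*_; _∸_)
open import Data.Integer using (+_)
open import Data.Rational using (_/_)
open import Data.Fin using (zero; punchIn; _≟_)
open import Data.Fin.Properties using (punchInᵢ≢i)
open import Data.Nat using (suc; z≤n; s≤s)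

other-element : ∀ {n} → 2 ≤ n → (z : Fin n) → ∃ λ z′ → z′ ≢ z
other-element (s≤s (s≤s _)) z = punchIn z zero , punchInᵢ≢i z zero

theorem3 : (n d k : ℕ) → .{{_ : NonZero n}} → 1 ≤ k → 3 ≤ d → 2 * (d + 1) ≤ n →
    ((C : Code (Circulant n (1 ∷ (d ∸ 1) ∷ d ∷ (d + 1) ∷ []))) →
      IsIdentifying (Circulant n (1 ∷ (d ∸ 1) ∷ d ∷ (d + 1) ∷ [])) C → codeSize n C ≡ k →
      ∃ λ (C' : Code KingGrid) → IsIdentifying KingGrid C' × HasDensity C' ((+ k) / n)) ×
    ((C : Code (Circulant n (1 ∷ (d ∸ 1) ∷ d ∷ (d + 1) ∷ []))) →
      IsLocatingDominating (Circulant n (1 ∷ (d ∸ 1) ∷ d ∷ (d + 1) ∷ [])) C → codeSize n C ≡ k →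
      ∃ λ (C' : Code KingGrid) → IsLocatingDominating KingGrid C' × HasDensity C' ((+ k) / n)) ×
    ((C : Code (Circulant n (1 ∷ (d ∸ 1) ∷ d ∷ (d + 1) ∷ []))) →
      IsSelfIdentifying (Circulant n (1 ∷ (d ∸ 1) ∷ d ∷ (d + 1) ∷ [])) C → codeSize n C ≡ k →
      ∃ λ (C' : Code KingGrid) → IsSelfIdentifying KingGrid C' × HasDensity C' ((+ k) / n))
theorem3 n (suc (suc (suc e))) k _ (s≤s (s≤s (s≤s _))) n-large =
  lift-code IsIdentifying (λ C → φ-Pullback.isIdentifying C φ-surjective _≟_ (fibre-separating C)) ,
  lift-code IsLocatingDominating (λ C → φ-Pullback.isLocatingDominating C φ-surjective _≟_ (fibre-separating C)) ,
  lift-code IsSelfIdentifying (λ C → φ-Pullback.isSelfIdentifying C φ-surjective _≟_ (fibre-separating C) (other-element (ℕP.≤-trans (s≤s (s≤s z≤n)) n-large)) ∈K?)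
  where
  open Covering e n n-large
  lift-code : ∀ (P : (G : Graph) → Code G → Set) → (∀ C → P Cₙ C → P KingGrid (C ∘ φ)) →
              ∀ C → P Cₙ C → codeSize n C ≡ k → ∃ λ (C' : Code KingGrid) → P KingGrid C' × HasDensity C' ((+ k) / n)
  lift-code _ lift C PC size = C ∘ φ , lift C PC , subst (λ c → HasDensity (C ∘ φ) ((+ c) / n)) size (LatticeCode.code-density n C D)
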